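{- Let $f:\{0,1\}^n\to\{0,1\}$ admit the block property. Then $\mathrm{bs}_0(f)\le 4\,\mathrm{s}(f)^2$. In particular, if $f$ admits the normalized block property, then $\mathrm{bs}(f)\le 4\,\mathrm{s}(f)^2$.
   Context: For $x\in\{0,1\}^n$, $x^i$ is $x$ with bit $i$ flipped and $x^B$ is $x$ with bits in $B\subseteq[n]$ flipped. $\mathrm{s}(f,x)=|\{i: f(x)\ne f(x^i)\}|$, $\mathrm{s}(f)=\max_x\mathrm{s}(f,x)$. $\mathrm{bs}(f,x)$ is the maximum $k$ such that there are pairwise disjoint $B_1,\dots,B_k\subseteq[n]$ with $f(x^{B_j})\ne f(x)$ for all $j$; $\mathrm{bs}(f)=\max_x\mathrm{bs}(f,x)$, $\mathrm{bs}_0(f)=\max_{x:f(x)=0}\mathrm{bs}(f,x)$. A DNF representation of $f$ is an OR of terms $\wedge_1,\dots,\wedge_{d_\vee}$, each an AND of literals with no term containing a variable and its negation; $A_i$ (resp. $\overline{A}_i$) is the set of variables appearing unnegated (resp. negated) in $\wedge_i$, and $S_i$ is the set of assignments satisfying $\wedge_i$. It is in compact form if (a) $f(0^n)=0$, (b) $\mathrm{bs}_0(f)=\mathrm{bs}(f,0^n)$, (c) for each $i$, $S_i\setminus\bigcup_{j\neq i}S_j\ne\emptyset$; it is normalized if also $\mathrm{bs}(f)=\mathrm{bs}(f,0^n)$. $f$ admits the block property if it has a compact form DNF representation with $A_i\cap A_j=\emptyset$ for all $i\ne j$, and the normalized block property if such a representation can be chosen normalized. -}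

module Defs where

open import Data.Nat using (ℕ; zero; suc; _+_; _*_; _^_; _≤_; _⊔_)
open import Data.Bool using (Bool; true; false; not; if_then_else_; _∧_; _∨_)
open import Data.Fin using (Fin; zero; suc)
open import Data.Maybe using (Maybe; just; nothing)
open import Data.List using (List; []; _∷_; map; _++_; foldr)
open import Data.Product using (Σ; _×_; _,_; ∃)
open import Relation.Binary.PropositionalEquality using (_≡_; _≢_)

-- inputs x ∈ {0,1}^n, with false = 0, true = 1
Input : ℕ → Set
Input n = Fin n → Bool

BoolFun : ℕ → Set
BoolFun n = Input n → Bool

zeros : ∀ {n} → Input n
zeros _ = false

Block : ℕ → Set
Block n = Fin n → Bool

flipB : ∀ {n} → Block n → Input n → Input n
flipB B x i = if B i then not (x i) else x i

single : ∀ {n} → Fin n → Block n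
single zero    zero    = true
single zero    (suc _) = false
single (suc i) zero    = false
single (suc i) (suc j) = single i j

flip1 : ∀ {n} → Fin n → Input n → Input n
flip1 i = flipB (single i)

differ : Bool → Bool → Bool
differ true  true  = false
differ false false = false
differ _     _     = true

count : ∀ {n} → (Fin n → Bool) → ℕ
count {zero}  p = 0
count {suc n} p = (if p zero then 1 else 0) + count (λ i → p (suc i))

sensAt : ∀ {n} → BoolFun n → Input n → ℕ
sensAt f x = count (λ i → differ (f x) (f (flip1 i x)))

allInputs : (n : ℕ) → List (Input n)
allInputs zero    = (λ ()) ∷ []
allInputs (suc n) = map (cons false) (allInputs n) ++ map (cons true) (allInputs n)
  where
  cons : Bool → Input n → Input (suc n)
  cons b x zero    = b
  cons b x (suc i) = x i

sens : ∀ {n} → BoolFun n → ℕ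
sens {n} f = foldr (λ x m → sensAt f x ⊔ m) 0 (allInputs n)

-- HasBlocks f x k : there are k pairwise disjoint blocks B_1..B_k with
-- f(x^{B_j}) ≠ f(x) for all j.  So bs(f,x) = max { k | HasBlocks f x k }.
HasBlocks : ∀ {n} → BoolFun n → Input n → ℕ → Set
HasBlocks {n} f x k =
  Σ (Fin k → Block n) λ B →
    (∀ j j' → j ≢ j' → ∀ i → B j i ≡ true → B j' i ≡ false)
    × (∀ j → f (flipB (B j) x) ≢ f x)

bsAt≤ : ∀ {n} → BoolFun n → Input n → ℕ → Set
bsAt≤ f x m = ∀ k → HasBlocks f x k → k ≤ m

bs0≤ : ∀ {n} → BoolFun n → ℕ → Set
bs0≤ f m = ∀ x → f x ≡ false → bsAt≤ f x m

bs≤ : ∀ {n} → BoolFun n → ℕ → Set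
bs≤ f m = ∀ x → bsAt≤ f x m

-- bs_0(f) = bs(f,0^n)   (given f(0^n)=0, so bs(f,0^n) ≤ bs_0(f) automatically):
-- every block count achievable at some 0-input is achievable at 0^n
Bs0AtZero : ∀ {n} → BoolFun n → Set
Bs0AtZero f = ∀ x → f x ≡ false → ∀ k → HasBlocks f x k → HasBlocks f zeros k

BsAtZero : ∀ {n} → BoolFun n → Set
BsAtZero f = ∀ x → ∀ k → HasBlocks f x k → HasBlocks f zeros k

-- DNF term: for each variable, just true = unnegated literal,
-- just false = negated literal, nothing = absent.
-- (This excludes a variable appearing together with its negation.)
Term : ℕ → Set
Term n = Fin n → Maybe Bool

litOK : Maybe Bool → Bool → Bool
litOK nothing      _     = true
litOK (just true)  b     = b
litOK (just false) b     = not b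

satTerm : ∀ {n} → Term n → Input n → Bool
satTerm {zero}  t x = true
satTerm {suc n} t x = litOK (t zero) (x zero) ∧ satTerm (λ i → t (suc i)) (λ i → x (suc i))

anyFin : ∀ {d} → (Fin d → Bool) → Bool
anyFin {zero}  p = false
anyFin {suc d} p = p zero ∨ anyFin (λ i → p (suc i))

DNF : ℕ → ℕ → Set
DNF n d = Fin d → Term n

evalDNF : ∀ {n d} → DNF n d → Input n → Bool
evalDNF T x = anyFin (λ i → satTerm (T i) x)

Represents : ∀ {n d} → DNF n d → BoolFun n → Set
Represents T f = ∀ x → evalDNF T x ≡ f x

Irredundant : ∀ {n d} → DNF n d → Set
Irredundant {n} T = ∀ i → ∃ λ (x : Input n) →
  satTerm (T i) x ≡ true × (∀ j → j ≢ i → satTerm (T j) x ≡ false)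

CompactForm : ∀ {n d} → DNF n d → BoolFun n → Set
CompactForm T f = Represents T f × f zeros ≡ false × Bs0AtZero f × Irredundant T

Normalized : ∀ {n d} → DNF n d → BoolFun n → Set
Normalized T f = CompactForm T f × BsAtZero f

DisjointPositive : ∀ {n d} → DNF n d → Set
DisjointPositive T = ∀ i j → i ≢ j → ∀ v → T i v ≡ just true → T j v ≢ just true

BlockProperty : ∀ {n} → BoolFun n → Set
BlockProperty {n} f = Σ ℕ λ d → Σ (DNF n d) λ T → CompactForm T f × DisjointPositive T

NormalizedBlockProperty : ∀ {n} → BoolFun n → Set
NormalizedBlockProperty {n} f = Σ ℕ λ d → Σ (DNF n d) λ T → Normalized T f × DisjointPositive T

-- Fix a block DNF T of f with d terms. Since f(0ⁿ) = 0 every positive set Aᵢ is nonempty; pick pᵢ ∈ Aᵢ.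
-- Disjoint blocks B flipping 0ⁿ to a 1-input are satisfied by distinct terms (p of that term lies in B),
-- so bs(f,0ⁿ) ≤ d. Flipping a variable u of term i at the indicator yᵢ of Aᵢ either falsifies f, or
-- (for u ∈ Āᵢ) lands in a term whose only positive variable is u, so f(eᵤ) = 1: hence
-- |Aᵢ| + |Āᵢ| ≤ s(f,yᵢ) + s(f,0ⁿ) ≤ 2s. In the conflict digraph i → j iff Āᵢ ∩ Aⱼ ≠ ∅, out-degrees are
-- therefore below 2s, and for an independent set I the input ⋃_{i∈I} Aᵢ ∖ {pᵢ} is a 0-input sensitive
-- at every pᵢ, so |I| ≤ s. A greedy independent set then forces d ≤ s · 4s.

module Submission where

open import Defs
open import Data.Bool using (Bool; true; false; not; if_then_else_; _∧_; _∨_)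
open import Data.Bool.Properties
  using ( ∨-identityʳ; ∨-zeroʳ; ∧-identityʳ; ∧-zeroʳ; ∨-inverseˡ; ∧-conicalˡ; ∧-conicalʳ
        ; not-involutive; ¬-not; not-¬ )
  renaming (_≟_ to _≟ᴮ_)
open import Data.Empty using (⊥; ⊥-elim)
open import Data.Fin using (Fin; zero; suc; fromℕ<)
open import Data.Fin.Properties using (any?; suc-injective; 0≢1+n; injective⇒≤) renaming (_≟_ to _≟ᶠ_)
open import Data.List using (_∷_; foldr)
open import Data.List.Relation.Unary.Any using (Any; here; there)
import Data.List.Relation.Unary.Any as Any
open import Data.List.Relation.Unary.Any.Properties using (map⁺; ++⁺ˡ; ++⁺ʳ)
open import Data.Maybe using (Maybe; just; nothing; is-just)
open import Data.Maybe.Properties using (≡-dec; just-injective)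
open import Data.Nat using (ℕ; zero; suc; _+_; _*_; _^_; _≤_; _<_; _⊔_; z≤n; s≤s; _≤?_)
open import Data.Nat.Properties
  using ( +-0-commutativeMonoid; +-*-semiring; module ≤-Reasoning; ≤-refl; ≤-reflexive; ≤-trans; ≤-pred
        ; ≤-<-trans; <-≤-trans; <⇒≱; ≰⇒>; n≤1+n; +-comm; +-suc; +-mono-≤; +-monoʳ-≤
        ; +-cancelʳ-≤; +-cancelʳ-<; *-identityˡ; *-suc; *-monoʳ-≤; m≤m⊔n; m≤n⊔m )
open import Algebra.Properties.CommutativeMonoid.Sum +-0-commutativeMonoid
  using (sum; sum-cong-≗; ∑-distrib-+; ∑-comm)
open import Algebra.Properties.Semiring.Sum +-*-semiring using (*-distribʳ-sum; *-distribˡ-sum)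
open import Data.Nat.Solver using (module +-*-Solver)
open +-*-Solver using (solve; _:+_; _:*_; _:^_; _:=_; con)
open import Data.Product using (Σ; ∃; _×_; _,_; proj₁; proj₂)
open import Data.Sum using (_⊎_; inj₁; inj₂)
open import Function using (_∘_)
open import Relation.Nullary using (yes; no; contradiction)
open import Relation.Nullary.Decidable using (_×-dec_)
open import Relation.Binary.PropositionalEquality

𝟙 : Bool → ℕ
𝟙 b = if b then 1 else 0

𝟙-mono : ∀ {a b} → (a ≡ true → b ≡ true) → 𝟙 a ≤ 𝟙 b
𝟙-mono {false} _ = z≤n
𝟙-mono {true}  h rewrite h refl = ≤-refl

𝟙-∧ : ∀ a b → 𝟙 (a ∧ b) ≡ 𝟙 a * 𝟙 b
𝟙-∧ true  b = sym (*-identityˡ (𝟙 b))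
𝟙-∧ false b = refl

not≡true : ∀ {b} → not b ≡ true → b ≡ false
not≡true {b} e = trans (sym (not-involutive b)) (cong not e)

_⊆_ : ∀ {n} → (Fin n → Bool) → (Fin n → Bool) → Set
p ⊆ q = ∀ i → p i ≡ true → q i ≡ true

single-self : ∀ {n} (i : Fin n) → single i i ≡ true
single-self zero    = refl
single-self (suc i) = single-self i

single-≢ : ∀ {n} {i j : Fin n} → i ≢ j → single i j ≡ false
single-≢ {i = zero}  {zero}  i≢j = contradiction refl i≢j
single-≢ {i = zero}  {suc j} _   = refl
single-≢ {i = suc i} {zero}  _   = refl
single-≢ {i = suc i} {suc j} i≢j = single-≢ (i≢j ∘ cong suc)

single⇒≡ : ∀ {n} {i j : Fin n} → single i j ≡ true → i ≡ j
single⇒≡ {i = zero}  {zero}  _ = refl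
single⇒≡ {i = suc i} {suc j} e = cong suc (single⇒≡ e)

count≡sum : ∀ {n} (p : Fin n → Bool) → count p ≡ sum (𝟙 ∘ p)
count≡sum {zero}  p = refl
count≡sum {suc n} p = cong (𝟙 (p zero) +_) (count≡sum (p ∘ suc))

count-cong : ∀ {n} {p q : Fin n → Bool} → (∀ i → p i ≡ q i) → count p ≡ count q
count-cong {zero}  _ = refl
count-cong {suc n} h = cong₂ _+_ (cong 𝟙 (h zero)) (count-cong (h ∘ suc))

count-mono : ∀ {n} {p q : Fin n → Bool} → p ⊆ q → count p ≤ count q
count-mono {zero}  _   = z≤n
count-mono {suc n} p⊆q = +-mono-≤ (𝟙-mono (p⊆q zero)) (count-mono (p⊆q ∘ suc))

sum-mono-≤ : ∀ {n} {a b : Fin n → ℕ} → (∀ i → a i ≤ b i) → sum a ≤ sum b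
sum-mono-≤ {zero}  _ = z≤n
sum-mono-≤ {suc n} h = +-mono-≤ (h zero) (sum-mono-≤ (h ∘ suc))

count-∨ : ∀ {n} (p q : Fin n → Bool) → count (λ i → p i ∨ q i) ≤ count p + count q
count-∨ p q = begin
  count (λ i → p i ∨ q i)        ≡⟨ count≡sum (λ i → p i ∨ q i) ⟩
  sum (λ i → 𝟙 (p i ∨ q i))      ≤⟨ sum-mono-≤ (λ i → 𝟙-∨ (p i) (q i)) ⟩
  sum (λ i → 𝟙 (p i) + 𝟙 (q i))  ≡⟨ ∑-distrib-+ (𝟙 ∘ p) (𝟙 ∘ q) ⟩
  sum (𝟙 ∘ p) + sum (𝟙 ∘ q)      ≡⟨ sym (cong₂ _+_ (count≡sum p) (count≡sum q)) ⟩
  count p + count q              ∎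
  where
  open ≤-Reasoning
  𝟙-∨ : ∀ a b → 𝟙 (a ∨ b) ≤ 𝟙 a + 𝟙 b
  𝟙-∨ true  b = s≤s z≤n
  𝟙-∨ false b = ≤-refl

count-insert : ∀ {n} (p : Fin n → Bool) (j : Fin n) → p j ≡ false →
               count (λ i → p i ∨ single j i) ≡ suc (count p)
count-insert {suc n} p zero pj rewrite pj = cong suc (count-cong (λ i → ∨-identityʳ (p (suc i))))
count-insert {suc n} p (suc j) pj = begin
  𝟙 (p zero ∨ false) + count (λ i → p (suc i) ∨ single j i)
    ≡⟨ cong₂ _+_ (cong 𝟙 (∨-identityʳ (p zero))) (count-insert (p ∘ suc) j pj) ⟩
  𝟙 (p zero) + suc (count (p ∘ suc))
    ≡⟨ +-suc (𝟙 (p zero)) _ ⟩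
  suc (count p)
    ∎
  where open ≡-Reasoning

count-none : ∀ n → count {n} (λ _ → false) ≡ 0
count-none zero    = refl
count-none (suc n) = count-none n

count-single : ∀ {n} (j : Fin n) → count (single j) ≡ 1
count-single {suc n} zero    = cong suc (count-none n)
count-single {suc n} (suc j) = count-single j

count-all : ∀ n → count {n} (λ _ → true) ≡ n
count-all zero    = refl
count-all (suc n) = cong suc (count-all n)

count-injective : ∀ {m n} {p : Fin m → Bool} {q : Fin n → Bool} (g : ∀ i → p i ≡ true → Fin n) →
                  (∀ i pᵢ → q (g i pᵢ) ≡ true) → (∀ i j pᵢ pⱼ → g i pᵢ ≡ g j pⱼ → i ≡ j) →
                  count p ≤ count q
count-injective {zero} g g∈q g-inj = z≤n
count-injective {suc m} {p = p} {q} g g∈q g-inj with p zero in p₀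
... | false = count-injective (λ i → g (suc i)) (λ i → g∈q (suc i))
                (λ i j pᵢ pⱼ → suc-injective ∘ g-inj (suc i) (suc j) pᵢ pⱼ)
... | true = begin
  suc (count (p ∘ suc))              ≤⟨ s≤s (count-injective (λ i → g (suc i)) g∈q′ g-inj′) ⟩
  suc (count q′)                     ≡⟨ count-insert q′ w q′-w ⟨
  count (λ i → q′ i ∨ single w i)    ≤⟨ count-mono q′+w⊆q ⟩
  count q                            ∎
  where
  open ≤-Reasoning
  w = g zero p₀
  q′ : Fin _ → Bool
  q′ i = q i ∧ not (single w i)
  q′-w : q′ w ≡ false
  q′-w rewrite single-self w = ∧-zeroʳ (q w)
  q′+w⊆q : (λ i → q′ i ∨ single w i) ⊆ q
  q′+w⊆q i qi with single w i in wi
  ... | true  = subst (λ k → q k ≡ true) (single⇒≡ wi) (g∈q zero p₀)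
  ... | false = trans (sym (∧-identityʳ (q i))) (trans (sym (∨-identityʳ _)) qi)
  g∈q′ : ∀ i pᵢ → q′ (g (suc i) pᵢ) ≡ true
  g∈q′ i pᵢ rewrite g∈q (suc i) pᵢ | single-≢ (0≢1+n ∘ g-inj zero (suc i) p₀ pᵢ) = refl
  g-inj′ : ∀ i j pᵢ pⱼ → g (suc i) pᵢ ≡ g (suc j) pⱼ → i ≡ j
  g-inj′ i j pᵢ pⱼ = suc-injective ∘ g-inj (suc i) (suc j) pᵢ pⱼ

module Digraph {d : ℕ} (E : Fin d → Fin d → Bool) (E-irrefl : ∀ i → E i i ≡ false) where

  Independent : (Fin d → Bool) → Set
  Independent I = ∀ i j → I i ≡ true → I j ≡ true → E i j ≡ false

  IndependentIn : (Fin d → Bool) → ℕ → Set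
  IndependentIn S c = Σ (Fin d → Bool) λ I → I ⊆ S × Independent I × c ≤ count I

  inDegree : (Fin d → Bool) → Fin d → ℕ
  inDegree S j = count (λ i → S i ∧ E i j)

  ∑-inDegree : ∀ S → sum (inDegree S) ≡ sum (λ i → 𝟙 (S i) * count (E i))
  ∑-inDegree S = begin
    sum (λ j → count (λ i → S i ∧ E i j))
      ≡⟨ sum-cong-≗ (λ j → count≡sum (λ i → S i ∧ E i j)) ⟩
    sum (λ j → sum (λ i → 𝟙 (S i ∧ E i j)))
      ≡⟨ ∑-comm (λ j i → 𝟙 (S i ∧ E i j)) ⟩
    sum (λ i → sum (λ j → 𝟙 (S i ∧ E i j)))
      ≡⟨ sum-cong-≗ (λ i → sum-cong-≗ (λ j → 𝟙-∧ (S i) (E i j))) ⟩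
    sum (λ i → sum (λ j → 𝟙 (S i) * 𝟙 (E i j)))
      ≡⟨ sum-cong-≗ (λ i → *-distribˡ-sum (𝟙 (S i)) (𝟙 ∘ E i)) ⟨
    sum (λ i → 𝟙 (S i) * sum (𝟙 ∘ E i))
      ≡⟨ sum-cong-≗ (λ i → cong (𝟙 (S i) *_) (count≡sum (E i))) ⟨
    sum (λ i → 𝟙 (S i) * count (E i))
      ∎
    where open ≡-Reasoning

  ∑-𝟙* : ∀ (S : Fin d → Bool) c → sum (λ i → 𝟙 (S i) * c) ≡ count S * c
  ∑-𝟙* S c = trans (sym (*-distribʳ-sum c (𝟙 ∘ S))) (cong (_* c) (sym (count≡sum S)))

  prune : (Fin d → Bool) → Fin d → Fin d → Bool
  prune S j i = S i ∧ not (single j i ∨ E j i ∨ E i j)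

  prune⊆ : ∀ S j i → prune S j i ≡ true →
           S i ≡ true × single j i ≡ false × E j i ≡ false × E i j ≡ false
  prune⊆ S j i e with S i | single j i | E j i | E i j
  prune⊆ S j i () | false | _     | _     | _
  prune⊆ S j i () | true  | true  | _     | _
  prune⊆ S j i () | true  | false | true  | _
  prune⊆ S j i () | true  | false | false | true
  prune⊆ S j i e  | true  | false | false | false = refl , refl , refl , refl

  extend : ∀ S j → S j ≡ true → ∀ c → IndependentIn (prune S j) c → IndependentIn S (suc c)
  extend S j Sj c (I′ , I′⊆ , I′-indep , c≤) = I , I⊆S , I-indep , c+1≤
    where
    I : Fin d → Bool
    I i = I′ i ∨ single j i
    I′-j : I′ j ≡ false
    I′-j = ¬-not λ I′j → let _ , j≢j , _ = prune⊆ S j j (I′⊆ j I′j) in not-¬ (single-self j) j≢j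
    in-I : ∀ i → I i ≡ true → I′ i ≡ true ⊎ j ≡ i
    in-I i e with I′ i
    ... | true  = inj₁ refl
    ... | false = inj₂ (single⇒≡ e)
    I⊆S : I ⊆ S
    I⊆S i e with in-I i e
    ... | inj₁ I′i  = proj₁ (prune⊆ S j i (I′⊆ i I′i))
    ... | inj₂ refl = Sj
    I-indep : Independent I
    I-indep a b Ia Ib with in-I a Ia | in-I b Ib
    ... | inj₁ I′a  | inj₁ I′b  = I′-indep a b I′a I′b
    ... | inj₁ I′a  | inj₂ refl = let _ , _ , _ , E-a-j = prune⊆ S j a (I′⊆ a I′a) in E-a-j
    ... | inj₂ refl | inj₁ I′b  = let _ , _ , E-j-b , _ = prune⊆ S j b (I′⊆ b I′b) in E-j-b
    ... | inj₂ refl | inj₂ refl = E-irrefl j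
    c+1≤ : suc c ≤ count I
    c+1≤ = subst (suc c ≤_) (sym (count-insert I′ j I′-j)) (s≤s c≤)

  module _ (D : ℕ) (outDegree≤ : ∀ i → count (E i) ≤ D) where

    -- Averaging: the in-degrees inside S sum to at most |S| · D.
    low-inDegree : ∀ S → 0 < count S → ∃ λ j → S j ≡ true × inDegree S j ≤ D
    low-inDegree S S≢∅ with any? (λ j → (S j ≟ᴮ true) ×-dec (inDegree S j ≤? D))
    ... | yes found = found
    ... | no none = contradiction (+-cancelʳ-≤ (count S * D) (count S) 0 |S|+|S|D≤|S|D) (<⇒≱ S≢∅)
      where
      high : ∀ j → S j ≡ true → suc D ≤ inDegree S j
      high j Sj = ≰⇒> λ low → none (j , Sj , low)
      𝟙*-mono : ∀ b {m n} → (b ≡ true → m ≤ n) → 𝟙 b * m ≤ 𝟙 b * n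
      𝟙*-mono true  m≤n = *-monoʳ-≤ 1 (m≤n refl)
      𝟙*-mono false _   = z≤n
      𝟙*≤ : ∀ b m → 𝟙 b * m ≤ m
      𝟙*≤ true  m = ≤-reflexive (*-identityˡ m)
      𝟙*≤ false m = z≤n
      |S|+|S|D≤|S|D : count S + count S * D ≤ count S * D
      |S|+|S|D≤|S|D = begin
        count S + count S * D                ≡⟨ *-suc (count S) D ⟨
        count S * suc D                      ≡⟨ ∑-𝟙* S (suc D) ⟨
        sum (λ j → 𝟙 (S j) * suc D)          ≤⟨ sum-mono-≤ (λ j → 𝟙*-mono (S j) (high j)) ⟩
        sum (λ j → 𝟙 (S j) * inDegree S j)   ≤⟨ sum-mono-≤ (λ j → 𝟙*≤ (S j) (inDegree S j)) ⟩
        sum (inDegree S)                     ≡⟨ ∑-inDegree S ⟩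
        sum (λ i → 𝟙 (S i) * count (E i))    ≤⟨ sum-mono-≤ (λ i → *-monoʳ-≤ (𝟙 (S i)) (outDegree≤ i)) ⟩
        sum (λ i → 𝟙 (S i) * D)              ≡⟨ ∑-𝟙* S D ⟩
        count S * D                          ∎
        where open ≤-Reasoning

    count-prune : ∀ S j → inDegree S j ≤ D → count S ≤ count (prune S j) + suc (D + D)
    count-prune S j low = begin
      count S                                                          ≤⟨ count-mono S⊆ ⟩
      count (λ i → prune S j i ∨ single j i ∨ E j i ∨ (S i ∧ E i j))   ≤⟨ count-∨ (prune S j) _ ⟩
      count (prune S j) + count (λ i → single j i ∨ E j i ∨ (S i ∧ E i j))
        ≤⟨ +-monoʳ-≤ (count (prune S j)) (count-∨ (single j) _) ⟩
      count (prune S j) + (count (single j) + count (λ i → E j i ∨ (S i ∧ E i j)))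
        ≤⟨ +-monoʳ-≤ (count (prune S j)) (+-mono-≤ (≤-reflexive (count-single j)) (count-∨ (E j) _)) ⟩
      count (prune S j) + suc (count (E j) + inDegree S j)
        ≤⟨ +-monoʳ-≤ (count (prune S j)) (s≤s (+-mono-≤ (outDegree≤ j) low)) ⟩
      count (prune S j) + suc (D + D)                                  ∎
      where
      open ≤-Reasoning
      S⊆ : S ⊆ (λ i → prune S j i ∨ single j i ∨ E j i ∨ (S i ∧ E i j))
      S⊆ i Si rewrite Si = ∨-inverseˡ (single j i ∨ E j i ∨ E i j)

    greedy-independent : ∀ k S → k * suc (D + D) < count S → IndependentIn S (suc k)
    greedy-independent k S k*M<|S| with low-inDegree S (≤-<-trans z≤n k*M<|S|)
    ... | j , Sj , low with k
    ...   | zero  = extend S j Sj 0 ((λ _ → false) , (λ _ ()) , (λ _ _ ()) , z≤n)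
    ...   | suc k = extend S j Sj (suc k) (greedy-independent k (prune S j) (+-cancelʳ-< M (k * M) _ k*M+M<))
      where
      M = suc (D + D)
      k*M+M< : k * M + M < count (prune S j) + M
      k*M+M< = subst (_< count (prune S j) + M) (+-comm M (k * M))
                     (<-≤-trans k*M<|S| (count-prune S j low))

  independence-bound : ∀ D a → (∀ i → count (E i) < D) → (∀ I → Independent I → count I ≤ a) →
                       d ≤ a * (D + D)
  independence-bound zero a outDegree< _ with d ≤? 0
  ... | yes d≤0 = ≤-trans d≤0 z≤n
  ... | no  d≰0 = contradiction (outDegree< (fromℕ< (≰⇒> d≰0))) λ ()
  independence-bound (suc D) a outDegree< independent≤ with d ≤? a * suc (D + D)
  ... | yes d≤ = ≤-trans d≤ (*-monoʳ-≤ a (s≤s (+-monoʳ-≤ D (n≤1+n D))))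
  ... | no  d≰ =
    let I , _ , I-indep , a<|I| = greedy-independent D (≤-pred ∘ outDegree<) a (λ _ → true)
                                    (subst (a * suc (D + D) <_) (sym (count-all d)) (≰⇒> d≰))
    in contradiction (independent≤ I I-indep) (<⇒≱ a<|I|)

flip1-self : ∀ {n} (u : Fin n) (x : Input n) → flip1 u x u ≡ not (x u)
flip1-self u x = cong (λ b → if b then not (x u) else x u) (single-self u)

flip1-other : ∀ {n} {u v : Fin n} (x : Input n) → u ≢ v → flip1 u x v ≡ x v
flip1-other {v = v} x u≢v = cong (λ b → if b then not (x v) else x v) (single-≢ u≢v)

flip1-cong : ∀ {n} (u : Fin n) {x y : Input n} → x ≗ y → flip1 u x ≗ flip1 u y
flip1-cong u x≗y v = cong (λ b → if single u v then not b else b) (x≗y v)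

flipB-zeros : ∀ {n} (B : Block n) v → flipB B zeros v ≡ true → B v ≡ true
flipB-zeros B v e with B v
... | true = refl

allInputs-complete : ∀ n (x : Input n) → Any (x ≗_) (allInputs n)
allInputs-complete zero    x = here λ ()
allInputs-complete (suc n) x with x zero in x₀
... | false = ++⁺ˡ (map⁺ (Any.map (λ x≗y → λ { zero → x₀ ; (suc i) → x≗y i })
                                (allInputs-complete n (x ∘ suc))))
... | true  = ++⁺ʳ _ (map⁺ (Any.map (λ x≗y → λ { zero → x₀ ; (suc i) → x≗y i })
                                  (allInputs-complete n (x ∘ suc))))

sensAt≤sens : ∀ {n} (f : BoolFun n) → (∀ {x y} → x ≗ y → f x ≡ f y) → ∀ x → sensAt f x ≤ sens f
sensAt≤sens {n} f f-cong x =
  foldr-⊔-≥ (allInputs n) (Any.map (≤-reflexive ∘ sensAt-cong) (allInputs-complete n x))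
  where
  sensAt-cong : ∀ {x y} → x ≗ y → sensAt f x ≡ sensAt f y
  sensAt-cong x≗y = count-cong λ i → cong₂ differ (f-cong x≗y) (f-cong (flip1-cong i x≗y))
  foldr-⊔-≥ : ∀ ys → Any (λ y → sensAt f x ≤ sensAt f y) ys →
              sensAt f x ≤ foldr (λ y m → sensAt f y ⊔ m) 0 ys
  foldr-⊔-≥ (y ∷ ys) (here  le) = ≤-trans le (m≤m⊔n _ _)
  foldr-⊔-≥ (y ∷ ys) (there le) = ≤-trans (foldr-⊔-≥ ys le) (m≤n⊔m (sensAt f y) _)

anyFin-sound : ∀ {d} (p : Fin d → Bool) → anyFin p ≡ true → ∃ λ i → p i ≡ true
anyFin-sound {suc d} p e with p zero in p₀
... | true  = zero , p₀
... | false = let i , pᵢ = anyFin-sound (p ∘ suc) e in suc i , pᵢ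

anyFin-complete : ∀ {d} (p : Fin d → Bool) i → p i ≡ true → anyFin p ≡ true
anyFin-complete p zero    e rewrite e = refl
anyFin-complete p (suc i) e rewrite anyFin-complete (p ∘ suc) i e = ∨-zeroʳ (p zero)

anyFin-none : ∀ {d} (p : Fin d → Bool) → (∀ i → p i ≡ false) → anyFin p ≡ false
anyFin-none {zero}  p _ = refl
anyFin-none {suc d} p h rewrite h zero = anyFin-none (p ∘ suc) (h ∘ suc)

anyFin-cong : ∀ {d} {p q : Fin d → Bool} → (∀ i → p i ≡ q i) → anyFin p ≡ anyFin q
anyFin-cong {zero}  _ = refl
anyFin-cong {suc d} h = cong₂ _∨_ (h zero) (anyFin-cong (h ∘ suc))

satTerm-sound : ∀ {n} (t : Term n) x → satTerm t x ≡ true → ∀ v → litOK (t v) (x v) ≡ true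
satTerm-sound {suc n} t x e zero    = ∧-conicalˡ _ _ e
satTerm-sound {suc n} t x e (suc v) = satTerm-sound (t ∘ suc) (x ∘ suc) (∧-conicalʳ _ _ e) v

satTerm-complete : ∀ {n} (t : Term n) x → (∀ v → litOK (t v) (x v) ≡ true) → satTerm t x ≡ true
satTerm-complete {zero}  t x _  = refl
satTerm-complete {suc n} t x ok rewrite ok zero = satTerm-complete (t ∘ suc) (x ∘ suc) (ok ∘ suc)

satTerm-cong : ∀ {n} (t : Term n) {x y : Input n} → x ≗ y → satTerm t x ≡ satTerm t y
satTerm-cong {zero}  t _   = refl
satTerm-cong {suc n} t x≗y =
  cong₂ _∧_ (cong (litOK (t zero)) (x≗y zero)) (satTerm-cong (t ∘ suc) (x≗y ∘ suc))

litOK-just : ∀ {b c} → litOK (just b) c ≡ true → c ≡ b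
litOK-just {true}  e = e
litOK-just {false} e = not≡true e

isPositive isNegative : Maybe Bool → Bool
isPositive (just b) = b
isPositive nothing  = false
isNegative (just b) = not b
isNegative nothing  = false

isPositive⇒ : ∀ {m} → isPositive m ≡ true → m ≡ just true
isPositive⇒ {just true} _ = refl

isNegative⇒ : ∀ {m} → isNegative m ≡ true → m ≡ just false
isNegative⇒ {just false} _ = refl

module BlockDNF {n d} (T : DNF n d) (f : BoolFun n) (rep : Represents T f)
                (f-zeros : f zeros ≡ false) (disjoint : DisjointPositive T) where

  f-cong : ∀ {x y} → x ≗ y → f x ≡ f y
  f-cong {x} {y} x≗y = trans (sym (rep x)) (trans (anyFin-cong λ i → satTerm-cong (T i) x≗y) (rep y))

  satisfied⇒true : ∀ {x} j → satTerm (T j) x ≡ true → f x ≡ true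
  satisfied⇒true {x} j e = trans (sym (rep x)) (anyFin-complete _ j e)

  true⇒satisfied : ∀ {x} → f x ≡ true → ∃ λ j → satTerm (T j) x ≡ true
  true⇒satisfied {x} e = anyFin-sound _ (trans (rep x) e)

  literal : ∀ {x} j v {b} → satTerm (T j) x ≡ true → T j v ≡ just b → x v ≡ b
  literal {x} j v sat e = litOK-just (subst (λ m → litOK m (x v) ≡ true) e (satTerm-sound (T j) x sat v))

  positive-unique : ∀ {i j u v} → T i u ≡ just true → T j v ≡ just true → u ≡ v → i ≡ j
  positive-unique {i} {j} {v = v} i∋v j∋v refl with i ≟ᶠ j
  ... | yes i≡j = i≡j
  ... | no  i≢j = contradiction j∋v (disjoint i j i≢j v i∋v)

  positive-nonempty : ∀ i → ∃ λ v → T i v ≡ just true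
  positive-nonempty i with any? (λ v → ≡-dec _≟ᴮ_ (T i v) (just true))
  ... | yes found = found
  ... | no  none  = ⊥-elim (not-¬ (satisfied⇒true i (satTerm-complete (T i) zeros zeros-ok)) f-zeros)
    where
    zeros-ok : ∀ v → litOK (T i v) false ≡ true
    zeros-ok v with T i v in e
    ... | nothing    = refl
    ... | just false = refl
    ... | just true  = contradiction (v , e) none

  pick : Fin d → Fin n
  pick i = proj₁ (positive-nonempty i)

  pick-positive : ∀ i → T i (pick i) ≡ just true
  pick-positive i = proj₂ (positive-nonempty i)

  blocks≤terms : ∀ k → HasBlocks f zeros k → k ≤ d
  blocks≤terms k (B , B-disjoint , B-flips) = injective⇒≤ term-injective
    where
    flip-true : ∀ j → f (flipB (B j) zeros) ≡ true
    flip-true j = ¬-not λ e → B-flips j (trans e (sym f-zeros))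
    term : Fin k → Fin d
    term j = proj₁ (true⇒satisfied (flip-true j))
    term-sat : ∀ j → satTerm (T (term j)) (flipB (B j) zeros) ≡ true
    term-sat j = proj₂ (true⇒satisfied (flip-true j))
    B∋pick : ∀ j → B j (pick (term j)) ≡ true
    B∋pick j = flipB-zeros (B j) _ (literal (term j) _ (term-sat j) (pick-positive (term j)))
    term-injective : ∀ {j j′} → term j ≡ term j′ → j ≡ j′
    term-injective {j} {j′} e with j ≟ᶠ j′
    ... | yes j≡j′ = j≡j′
    ... | no  j≢j′ = ⊥-elim (not-¬ (subst (λ t → B j′ (pick t) ≡ true) (sym e) (B∋pick j′))
                                   (B-disjoint j j′ j≢j′ _ (B∋pick j)))

  sensitive : Input n → Fin n → Bool
  sensitive x u = differ (f x) (f (flip1 u x))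

  s : ℕ
  s = sens f

  sensAt≤s : ∀ x → sensAt f x ≤ s
  sensAt≤s = sensAt≤sens f f-cong

  indicator : Fin d → Input n
  indicator i u = isPositive (T i u)

  indicator-true : ∀ i → f (indicator i) ≡ true
  indicator-true i = satisfied⇒true i (satTerm-complete (T i) (indicator i) λ v → lit-ok (T i v))
    where
    lit-ok : ∀ m → litOK m (isPositive m) ≡ true
    lit-ok nothing      = refl
    lit-ok (just true)  = refl
    lit-ok (just false) = refl

  positive-of-flipped-indicator : ∀ {i j u} v → satTerm (T j) (flip1 u (indicator i)) ≡ true →
                                  T j v ≡ just true → u ≢ v → j ≡ i
  positive-of-flipped-indicator {i} {j} {u} v sat j∋v u≢v =
    positive-unique j∋v (isPositive⇒ (trans (sym (flip1-other (indicator i) u≢v)) (literal j v sat j∋v))) refl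

  positive⇒flip-false : ∀ {i u} → T i u ≡ just true → f (flip1 u (indicator i)) ≡ false
  positive⇒flip-false {i} {u} i∋u = ¬-not (no-term ∘ proj₂ ∘ true⇒satisfied)
    where
    x′ = flip1 u (indicator i)
    x′-u : x′ u ≡ false
    x′-u = trans (flip1-self u (indicator i)) (cong (not ∘ isPositive) i∋u)
    no-term : ∀ {j} → satTerm (T j) x′ ≡ true → ⊥
    no-term {j} sat = not-¬ (literal i u sat-i i∋u) x′-u
      where
      u≢pick : u ≢ pick j
      u≢pick refl = not-¬ (literal j u sat (pick-positive j)) x′-u
      sat-i : satTerm (T i) x′ ≡ true
      sat-i = subst (λ t → satTerm (T t) x′ ≡ true)
                    (positive-of-flipped-indicator (pick j) sat (pick-positive j) u≢pick) sat

  negative⇒flip-zeros : ∀ {i u} → T i u ≡ just false →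
                        f (flip1 u (indicator i)) ≡ true → f (flip1 u zeros) ≡ true
  negative⇒flip-zeros {i} {u} i∋¬u f-flip = satisfied⇒true j (satTerm-complete (T j) _ lit-ok)
    where
    j = proj₁ (true⇒satisfied f-flip)
    sat = proj₂ (true⇒satisfied f-flip)
    x′-u : flip1 u (indicator i) u ≡ true
    x′-u = trans (flip1-self u (indicator i)) (cong (not ∘ isPositive) i∋¬u)
    j≢i : j ≢ i
    j≢i j≡i = not-¬ x′-u (literal j u sat (subst (λ t → T t u ≡ just false) (sym j≡i) i∋¬u))
    lit-ok : ∀ v → litOK (T j v) (flip1 u zeros v) ≡ true
    lit-ok v with T j v in j∋v
    ... | nothing    = refl
    ... | just true  with u ≟ᶠ v
    ...   | yes refl = flip1-self u zeros
    ...   | no  u≢v  = ⊥-elim (j≢i (positive-of-flipped-indicator v sat j∋v u≢v))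
    lit-ok v | just false with u ≟ᶠ v
    ...   | yes refl = ⊥-elim (not-¬ x′-u (literal j u sat j∋v))
    ...   | no  u≢v  = cong not (flip1-other zeros u≢v)

  literals≤2s : ∀ i → count (λ u → is-just (T i u)) ≤ s + s
  literals≤2s i = begin
    count (λ u → is-just (T i u))                               ≤⟨ count-mono literal⇒sensitive ⟩
    count (λ u → sensitive (indicator i) u ∨ sensitive zeros u) ≤⟨ count-∨ (sensitive _) (sensitive _) ⟩
    sensAt f (indicator i) + sensAt f zeros                     ≤⟨ +-mono-≤ (sensAt≤s _) (sensAt≤s _) ⟩
    s + s                                                       ∎
    where
    open ≤-Reasoning
    literal⇒sensitive : (λ u → is-just (T i u)) ⊆ (λ u → sensitive (indicator i) u ∨ sensitive zeros u)
    literal⇒sensitive u _ with T i u in i∋u | f (flip1 u (indicator i)) in f-flip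
    ... | just true  | true  = ⊥-elim (not-¬ f-flip (positive⇒flip-false i∋u))
    ... | just true  | false rewrite indicator-true i = refl
    ... | just false | false rewrite indicator-true i = refl
    ... | just false | true  rewrite f-zeros | negative⇒flip-zeros i∋u f-flip = ∨-zeroʳ _

  clash : Fin d → Fin d → Fin n → Bool
  clash i j u = isNegative (T i u) ∧ isPositive (T j u)

  conflict : Fin d → Fin d → Bool
  conflict i j = anyFin (clash i j)

  conflict-irrefl : ∀ i → conflict i i ≡ false
  conflict-irrefl i = anyFin-none (clash i i) λ u → neg∧pos (T i u)
    where
    neg∧pos : ∀ m → isNegative m ∧ isPositive m ≡ false
    neg∧pos nothing      = refl
    neg∧pos (just true)  = refl
    neg∧pos (just false) = refl

  outDegree<2s : ∀ i → count (conflict i) < s + s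
  outDegree<2s i = begin-strict
    count (conflict i)                            ≤⟨ count-injective witness witness-negative witness-injective ⟩
    count negative                                <⟨ ≤-reflexive (sym (count-insert negative _ negative-pick)) ⟩
    count (λ u → negative u ∨ single (pick i) u)  ≤⟨ count-mono ⊆literals ⟩
    count (λ u → is-just (T i u))                 ≤⟨ literals≤2s i ⟩
    s + s                                         ∎
    where
    open ≤-Reasoning
    negative : Fin n → Bool
    negative u = isNegative (T i u)
    negative-pick : negative (pick i) ≡ false
    negative-pick = cong isNegative (pick-positive i)
    witness : ∀ j → conflict i j ≡ true → Fin n
    witness j e = proj₁ (anyFin-sound (clash i j) e)
    clash-witness : ∀ j e → clash i j (witness j e) ≡ true
    clash-witness j e = proj₂ (anyFin-sound (clash i j) e)
    witness-negative : ∀ j e → negative (witness j e) ≡ true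
    witness-negative j e = ∧-conicalˡ _ _ (clash-witness j e)
    witness-positive : ∀ j e → T j (witness j e) ≡ just true
    witness-positive j e = isPositive⇒ (∧-conicalʳ (negative (witness j e)) _ (clash-witness j e))
    witness-injective : ∀ j j′ e e′ → witness j e ≡ witness j′ e′ → j ≡ j′
    witness-injective j j′ e e′ = positive-unique (witness-positive j e) (witness-positive j′ e′)
    ⊆literals : (λ u → negative u ∨ single (pick i) u) ⊆ (λ u → is-just (T i u))
    ⊆literals u e with negative u in neg-u | single (pick i) u in pick≡u
    ... | true  | _    = cong is-just (isNegative⇒ neg-u)
    ... | false | true = cong is-just (subst (λ v → T i v ≡ just true) (single⇒≡ pick≡u) (pick-positive i))

  open Digraph conflict conflict-irrefl using (Independent; independence-bound)

  module Cover (I : Fin d → Bool) (independent : Independent I) where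

    covers : Fin n → Fin d → Bool
    covers u i = I i ∧ isPositive (T i u) ∧ not (single (pick i) u)

    cover : Input n
    cover u = anyFin (covers u)

    covered : ∀ {u i} → covers u i ≡ true → I i ≡ true × T i u ≡ just true × single (pick i) u ≡ false
    covered {u} {i} e = ∧-conicalˡ _ _ e , isPositive⇒ (∧-conicalˡ _ _ rest) , not≡true (∧-conicalʳ _ _ rest)
      where rest = ∧-conicalʳ (I i) _ e

    cover-pick : ∀ j → cover (pick j) ≡ false
    cover-pick j = ¬-not (uncovered ∘ proj₂ ∘ anyFin-sound (covers (pick j)))
      where
      uncovered : ∀ {i} → covers (pick j) i ≡ true → ⊥
      uncovered {i} e with covered e
      ... | _ , i∋pick-j , pick-i≢pick-j with positive-unique i∋pick-j (pick-positive j) refl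
      ...   | refl = not-¬ (single-self (pick i)) pick-i≢pick-j

    f-cover : f cover ≡ false
    f-cover = ¬-not λ f-cover≡true → let j , sat = true⇒satisfied f-cover≡true in
      not-¬ (literal j (pick j) sat (pick-positive j)) (cover-pick j)

    uncovered-negative : ∀ {i v} → I i ≡ true → T i v ≡ just false → cover v ≡ false
    uncovered-negative {i} {v} I-i i∋¬v = ¬-not (conflicting ∘ proj₂ ∘ anyFin-sound (covers v))
      where
      conflicting : ∀ {i′} → covers v i′ ≡ true → ⊥
      conflicting {i′} e with covered e
      ... | I-i′ , i′∋v , _ =
        not-¬ (anyFin-complete (clash i i′) v (cong₂ _∧_ (cong isNegative i∋¬v) (cong isPositive i′∋v)))
              (independent i i′ I-i I-i′)

    sensitive-at-pick : ∀ i → I i ≡ true → sensitive cover (pick i) ≡ true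
    sensitive-at-pick i I-i = cong₂ differ f-cover (satisfied⇒true i (satTerm-complete (T i) _ lit-ok))
      where
      lit-ok : ∀ v → litOK (T i v) (flip1 (pick i) cover v) ≡ true
      lit-ok v with T i v in i∋v | pick i ≟ᶠ v
      ... | nothing    | _          = refl
      ... | just true  | yes refl   = trans (flip1-self (pick i) cover) (cong not (cover-pick i))
      ... | just true  | no  pick≢v =
        trans (flip1-other cover pick≢v)
              (anyFin-complete (covers v) i
                 (cong₂ _∧_ I-i (cong₂ _∧_ (cong isPositive i∋v) (cong not (single-≢ pick≢v)))))
      ... | just false | yes refl   = contradiction (just-injective (trans (sym (pick-positive i)) i∋v)) λ ()
      ... | just false | no  pick≢v = cong not (trans (flip1-other cover pick≢v) (uncovered-negative I-i i∋v))

  independent≤s : ∀ I → Independent I → count I ≤ s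
  independent≤s I independent = begin
    count I
      ≤⟨ count-injective (λ i _ → pick i) sensitive-at-pick
                         (λ i j _ _ → positive-unique (pick-positive i) (pick-positive j)) ⟩
    sensAt f cover
      ≤⟨ sensAt≤s cover ⟩
    s
      ∎
    where
    open ≤-Reasoning
    open Cover I independent

  terms≤4s² : d ≤ 4 * s ^ 2
  terms≤4s² = subst (d ≤_) (4s²≡ s) (independence-bound (s + s) s outDegree<2s independent≤s)
    where
    4s²≡ : ∀ t → t * ((t + t) + (t + t)) ≡ 4 * t ^ 2
    4s²≡ = solve 1 (λ t → t :* ((t :+ t) :+ (t :+ t)) := con 4 :* (t :^ 2)) refl

  bsAtZero≤4s² : bsAt≤ f zeros (4 * s ^ 2)
  bsAtZero≤4s² k blocks = ≤-trans (blocks≤terms k blocks) terms≤4s²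

theorem5 : ∀ (n : ℕ) (f : BoolFun n) →
    (BlockProperty f → bs0≤ f (4 * sens f ^ 2))
    × (NormalizedBlockProperty f → bs≤ f (4 * sens f ^ 2))
theorem5 n f = bs₀-bound , bs-bound
  where
  bs₀-bound : BlockProperty f → bs0≤ f (4 * sens f ^ 2)
  bs₀-bound (_ , T , (rep , f-zeros , bs₀-at-zeros , _) , disjoint) x fx k blocks =
    BlockDNF.bsAtZero≤4s² T f rep f-zeros disjoint k (bs₀-at-zeros x fx k blocks)
  bs-bound : NormalizedBlockProperty f → bs≤ f (4 * sens f ^ 2)
  bs-bound (_ , T , ((rep , f-zeros , _) , bs-at-zeros) , disjoint) x k blocks =
    BlockDNF.bsAtZero≤4s² T f rep f-zeros disjoint k (bs-at-zeros x k blocks)
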